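{- Let $q\ge1$ and let $F\subseteq E$ be a feasible solution to $(2,q-1)$-FGC, i.e., every $\emptyset\ne A\subsetneq V$ satisfies $|\delta_{F\cap\mathcal{S}}(A)|\ge2$ or $|\delta_F(A)|\ge q+1$. Let $\mathcal{C}=\{\emptyset\ne A\subsetneq V: |\delta_{F\cap\mathcal{S}}(A)|<2 \text{ and } |\delta_F(A)|=q+1\}$ be the family of violated cuts. Then $\mathcal{C}$ is uncrossable.
   Context: $G=(V,E)$ is an undirected (multi)graph whose edges are partitioned into safe edges $\mathcal{S}$ and unsafe edges $\mathcal{U}$; $\delta_F(A)$ denotes the edges of $F$ with exactly one endpoint in $A$. A family $\mathcal{C}\subseteq 2^V$ is uncrossable if for all $A,B\in\mathcal{C}$, either $A\cup B\in\mathcal{C}$ and $A\cap B\in\mathcal{C}$, or $A\setminus B\in\mathcal{C}$ and $B\setminus A\in\mathcal{C}$. -}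

module Defs where

open import Data.Nat using (ℕ; _<_; _≤_; suc)
open import Data.Bool using (Bool; _∧_; _xor_)
open import Data.Fin using (Fin)
open import Data.Fin.Subset using (Subset; _∈_; _∩_; _∪_; _─_; ∁; ∣_∣; Nonempty)
open import Data.Vec using (Vec; lookup; tabulate)
open import Data.Product using (_×_; proj₁; proj₂)
open import Data.Sum using (_⊎_)
open import Relation.Binary.PropositionalEquality using (_≡_)

-- An undirected multigraph on vertex set V = Fin n with edge set E = Fin m;
-- edge e has endpoints (proj₁ (ends e), proj₂ (ends e)) (loops allowed).
record MultiGraph (n m : ℕ) : Set where
  field
    ends : Fin m → Fin n × Fin n
open MultiGraph public

δ : ∀ {n m} → MultiGraph n m → Subset m → Subset n → Subset m
δ G F A = tabulate λ e →
  lookup F e ∧ (lookup A (proj₁ (ends G e)) xor lookup A (proj₂ (ends G e)))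

ProperCut : ∀ {n} → Subset n → Set
ProperCut A = Nonempty A × Nonempty (∁ A)

Family : ℕ → Set₁
Family n = Subset n → Set

Uncrossable : ∀ {n} → Family n → Set
Uncrossable {n} 𝒞 = ∀ (A B : Subset n) → 𝒞 A → 𝒞 B →
  (𝒞 (A ∪ B) × 𝒞 (A ∩ B)) ⊎ (𝒞 (A ─ B) × 𝒞 (B ─ A))

-- F is feasible for (2,q-1)-FGC, where 𝒮 is the set of safe edges
-- (unsafe edges 𝒰 are the complement ∁ 𝒮).
FeasibleFGC : ∀ {n m} → MultiGraph n m → Subset m → ℕ → Subset m → Set
FeasibleFGC {n} G 𝒮 q F = ∀ (A : Subset n) → ProperCut A →
  (2 ≤ ∣ δ G (F ∩ 𝒮) A ∣) ⊎ (suc q ≤ ∣ δ G F A ∣)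

Violated : ∀ {n m} → MultiGraph n m → Subset m → ℕ → Subset m → Family n
Violated G 𝒮 q F A =
  ProperCut A × (∣ δ G (F ∩ 𝒮) A ∣ < 2) × (∣ δ G F A ∣ ≡ suc q)

{-# OPTIONS --safe #-}
-- For every edge set, the cut function d(X) = |δ(X)| is symmetric, submodular and
-- posimodular, and d(A∖B) is at most both d(A) + d(A∩B) and d(A∪B) + d(B).
-- Take violated A and B. If one of the atoms A∩B, A∖B, B∖A, V∖(A∪B) is empty, the pair
-- (A∪B, A∩B) or (A∖B, B∖A) consists of A, B or their complements. Otherwise all four sets
-- are proper cuts. If A∩B and A∪B both have fewer than two safe edges, feasibility gives
-- each at least q+1 edges, and submodularity with d_F(A) = d_F(B) = q+1 forces equality.
-- Otherwise one of them has at least two safe edges, so by submodularity of d_{F∩𝒮} the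
-- other has none; then A∖B and B∖A have fewer than two safe edges, and the same argument
-- with posimodularity applies.
module Submission where

open import Defs
open import Data.Bool using (Bool; true; false; not; _∧_; _∨_; _xor_)
open import Data.Bool.Properties using (∧-zeroʳ; ∧-identityʳ; xor-annihilates-not)
open import Data.Fin using (Fin; zero; suc)
open import Data.Fin.Subset
  using (Subset; inside; outside; _⊆_; _∩_; _∪_; _─_; ∁; ∣_∣; Nonempty; Empty)
open import Data.Fin.Subset.Properties
  using ( nonempty?; ⊆-trans; ⊆-antisym; x∈p⇒x∉∁p; x∈∁p⇒x∉p; x∉∁p⇒x∈p; x∉p⇒x∈∁p
        ; p⊆q⇒∁p⊇∁q; ∩-comm; ∪-comm; p∩q⊆p; x∈p∩q⁺; p⊆p∪q; q⊆p∪q; x∈p∪q⁻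
        ; x∈p∧x∉q⇒x∈p─q; p─q⊆p)
open import Data.Nat using (ℕ; zero; suc; _+_; _≤_; _<_; z≤n; _≤?_; _<?_)
open import Data.Nat.Properties
  using ( ≤-trans; ≤-reflexive; ≤-antisym; ≤-pred; +-mono-≤; +-monoˡ-≤; +-monoʳ-≤
        ; +-cancelˡ-≤; +-cancelʳ-≤; +-identityʳ; +-comm; m≤m+n; n≤0⇒n≡0; <⇒≱; ≮⇒≥
        ; +-commutativeSemigroup; module ≤-Reasoning)
open import Algebra.Properties.CommutativeSemigroup +-commutativeSemigroup using (interchange)
open import Data.Product using (_×_; _,_; proj₁; proj₂; swap)
open import Data.Sum using (_⊎_; inj₁; inj₂; [_,_]′)
open import Data.Vec using (_∷_; here; there; lookup; tabulate)
open import Data.Vec.Properties using (lookup-zipWith; lookup-map; tabulate-cong)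
open import Function using (_∘_; id)
open import Relation.Binary.PropositionalEquality
  using (_≡_; refl; sym; trans; cong; cong₂; subst; subst₂; _≗_)
open import Relation.Nullary.Decidable using (Dec; yes; no; True; toWitness; map′; _×-dec_)
open import Relation.Nullary.Negation using (contradiction)

private
  variable
    n : ℕ
    p q : Subset n

squeeze : ∀ {k x y} → k ≤ x → k ≤ y → x + y ≤ k + k → x ≡ k × y ≡ k
squeeze {k} {x} {y} k≤x k≤y x+y≤k+k =
  ≤-antisym (+-cancelʳ-≤ k x k (≤-trans (+-monoʳ-≤ x k≤y) x+y≤k+k)) k≤x ,
  ≤-antisym (+-cancelˡ-≤ k y k (≤-trans (+-monoˡ-≤ y k≤x) x+y≤k+k)) k≤y

2≤x⇒y≡0 : ∀ {a b x y} → a < 2 → b < 2 → x + y ≤ a + b → 2 ≤ x → y ≡ 0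
2≤x⇒y≡0 {a} {b} {x} {y} a<2 b<2 x+y≤a+b 2≤x = n≤0⇒n≡0 (+-cancelˡ-≤ 2 y 0 (begin
  2 + y  ≤⟨ +-monoˡ-≤ y 2≤x ⟩
  x + y  ≤⟨ x+y≤a+b ⟩
  a + b  ≤⟨ +-mono-≤ (≤-pred a<2) (≤-pred b<2) ⟩
  2      ∎))
  where open ≤-Reasoning

⟦_⟧ : Bool → ℕ
⟦ true ⟧  = 1
⟦ false ⟧ = 0

∣tabulate∣-suc : ∀ {m} (f : Fin (suc m) → Bool) → ∣ tabulate f ∣ ≡ ⟦ f zero ⟧ + ∣ tabulate (f ∘ suc) ∣
∣tabulate∣-suc f with f zero
... | true  = refl
... | false = refl

∣tabulate∣-mono₂ : ∀ {m} {f g h k : Fin m → Bool} →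
  (∀ i → ⟦ f i ⟧ + ⟦ g i ⟧ ≤ ⟦ h i ⟧ + ⟦ k i ⟧) →
  ∣ tabulate f ∣ + ∣ tabulate g ∣ ≤ ∣ tabulate h ∣ + ∣ tabulate k ∣
∣tabulate∣-mono₂ {zero}  _ = z≤n
∣tabulate∣-mono₂ {suc m} {f} {g} {h} {k} pointwise = begin
  ∣ tabulate f ∣ + ∣ tabulate g ∣
    ≡⟨ cong₂ _+_ (∣tabulate∣-suc f) (∣tabulate∣-suc g) ⟩
  (⟦ f zero ⟧ + ∣f′∣) + (⟦ g zero ⟧ + ∣g′∣)
    ≡⟨ interchange ⟦ f zero ⟧ ∣f′∣ ⟦ g zero ⟧ ∣g′∣ ⟩
  (⟦ f zero ⟧ + ⟦ g zero ⟧) + (∣f′∣ + ∣g′∣)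
    ≤⟨ +-mono-≤ (pointwise zero) (∣tabulate∣-mono₂ (pointwise ∘ suc)) ⟩
  (⟦ h zero ⟧ + ⟦ k zero ⟧) + (∣h′∣ + ∣k′∣)
    ≡⟨ interchange ⟦ h zero ⟧ ⟦ k zero ⟧ ∣h′∣ ∣k′∣ ⟩
  (⟦ h zero ⟧ + ∣h′∣) + (⟦ k zero ⟧ + ∣k′∣)
    ≡⟨ sym (cong₂ _+_ (∣tabulate∣-suc h) (∣tabulate∣-suc k)) ⟩
  ∣ tabulate h ∣ + ∣ tabulate k ∣
    ∎
  where
  open ≤-Reasoning
  ∣f′∣ ∣g′∣ ∣h′∣ ∣k′∣ : ℕ
  ∣f′∣ = ∣ tabulate (f ∘ suc) ∣
  ∣g′∣ = ∣ tabulate (g ∘ suc) ∣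
  ∣h′∣ = ∣ tabulate (h ∘ suc) ∣
  ∣k′∣ = ∣ tabulate (k ∘ suc) ∣

∣tabulate∣-mono₁ : ∀ {m} {f h k : Fin m → Bool} →
  (∀ i → ⟦ f i ⟧ ≤ ⟦ h i ⟧ + ⟦ k i ⟧) →
  ∣ tabulate f ∣ ≤ ∣ tabulate h ∣ + ∣ tabulate k ∣
∣tabulate∣-mono₁ pointwise = ≤-trans (m≤m+n _ _)
  (∣tabulate∣-mono₂ {g = λ _ → false} (λ i → ≤-trans (≤-reflexive (+-identityʳ _)) (pointwise i)))

∀-Bool? : {P : Bool → Set} → (∀ b → Dec (P b)) → Dec (∀ b → P b)
∀-Bool? P? = map′ (λ (t , f) → λ { true → t ; false → f }) (λ P → P true , P false)
                  (P? true ×-dec P? false)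

by-truth-table : {P : Bool → Bool → Bool → Bool → Bool → Set}
  (P? : ∀ f x y x′ y′ → Dec (P f x y x′ y′)) →
  {True (∀-Bool? λ f → ∀-Bool? λ x → ∀-Bool? λ y → ∀-Bool? λ x′ → ∀-Bool? λ y′ → P? f x y x′ y′)} →
  ∀ f x y x′ y′ → P f x y x′ y′
by-truth-table P? {holds} = toWitness holds

lookup-─ : ∀ (p q : Subset n) i → lookup (p ─ q) i ≡ lookup p i ∧ not (lookup q i)
lookup-─ (s ∷ p) (inside  ∷ q) zero    = sym (∧-zeroʳ s)
lookup-─ (s ∷ p) (outside ∷ q) zero    = sym (∧-identityʳ s)
lookup-─ (_ ∷ p) (_       ∷ q) (suc i) = lookup-─ p q i

p─q⊆∁q : ∀ (p q : Subset n) → p ─ q ⊆ ∁ q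
p─q⊆∁q (_ ∷ p) (outside ∷ q) here          = here
p─q⊆∁q (_ ∷ p) (_       ∷ q) (there x∈p─q) = there (p─q⊆∁q p q x∈p─q)

q─p⊆∁[p─q] : ∀ (p q : Subset n) → q ─ p ⊆ ∁ (p ─ q)
q─p⊆∁[p─q] p q = ⊆-trans (p─q⊆∁q q p) (p⊆q⇒∁p⊇∁q (p─q⊆p p q))

p∩q⊆p∪q : ∀ (p q : Subset n) → p ∩ q ⊆ p ∪ q
p∩q⊆p∪q p q = ⊆-trans (p∩q⊆p p q) (p⊆p∪q q)

Nonempty-mono : p ⊆ q → Nonempty p → Nonempty q
Nonempty-mono p⊆q (x , x∈p) = x , p⊆q x∈p

Nonempty-∁∁ : Nonempty p → Nonempty (∁ (∁ p))
Nonempty-∁∁ = Nonempty-mono (x∉p⇒x∈∁p ∘ x∈p⇒x∉∁p)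

p∩q-Empty⇒p─q≡p : ∀ (p q : Subset n) → Empty (p ∩ q) → p ─ q ≡ p
p∩q-Empty⇒p─q≡p p q p∩q=∅ = ⊆-antisym (p─q⊆p p q) λ x∈p →
  x∈p∧x∉q⇒x∈p─q x∈p λ x∈q → p∩q=∅ (_ , x∈p∩q⁺ (x∈p , x∈q))

∁[p∪q]-Empty⇒p─q≡∁q : ∀ (p q : Subset n) → Empty (∁ (p ∪ q)) → p ─ q ≡ ∁ q
∁[p∪q]-Empty⇒p─q≡∁q p q ∁[p∪q]=∅ = ⊆-antisym (p─q⊆∁q p q) λ x∈∁q →
  x∈p∧x∉q⇒x∈p─q (∁q⊆p x∈∁q) (x∈∁p⇒x∉p x∈∁q)
  where
  ∁q⊆p : ∁ q ⊆ p
  ∁q⊆p x∈∁q = x∉∁p⇒x∈p λ x∈∁p →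
    ∁[p∪q]=∅ (_ , x∉p⇒x∈∁p ([ x∈∁p⇒x∉p x∈∁p , x∈∁p⇒x∉p x∈∁q ]′ ∘ x∈p∪q⁻ p q))

p─q-Empty⇒p⊆q : ∀ (p q : Subset n) → Empty (p ─ q) → p ⊆ q
p─q-Empty⇒p⊆q p q p─q=∅ x∈p = x∉∁p⇒x∈p λ x∈∁q →
  p─q=∅ (_ , x∈p∧x∉q⇒x∈p─q x∈p (x∈∁p⇒x∉p x∈∁q))

p⊆q⇒p∩q≡p : p ⊆ q → p ∩ q ≡ p
p⊆q⇒p∩q≡p {p = p} {q} p⊆q = ⊆-antisym (p∩q⊆p p q) λ x∈p → x∈p∩q⁺ (x∈p , p⊆q x∈p)

p⊆q⇒p∪q≡q : p ⊆ q → p ∪ q ≡ q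
p⊆q⇒p∪q≡q {p = p} {q} p⊆q = ⊆-antisym ([ p⊆q , id ]′ ∘ x∈p∪q⁻ p q) (q⊆p∪q p q)

∩-∪-proper : Nonempty (p ∩ q) → Nonempty (∁ (p ∪ q)) → ProperCut (p ∩ q) × ProperCut (p ∪ q)
∩-∪-proper {p = p} {q} p∩q≠∅ ∁[p∪q]≠∅ =
  (p∩q≠∅ , Nonempty-mono (p⊆q⇒∁p⊇∁q (p∩q⊆p∪q p q)) ∁[p∪q]≠∅) ,
  (Nonempty-mono (p∩q⊆p∪q p q) p∩q≠∅ , ∁[p∪q]≠∅)

─-proper : Nonempty (p ─ q) → Nonempty (q ─ p) → ProperCut (p ─ q)
─-proper {p = p} {q} p─q≠∅ q─p≠∅ = p─q≠∅ , Nonempty-mono (q─p⊆∁[p─q] p q) q─p≠∅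

Uncrosses : Family n → Subset n → Subset n → Set
Uncrosses 𝒞 A B = (𝒞 (A ∪ B) × 𝒞 (A ∩ B)) ⊎ (𝒞 (A ─ B) × 𝒞 (B ─ A))

module _ (𝒞 : Family n) where

  Uncrosses-sym : ∀ {A B} → Uncrosses 𝒞 B A → Uncrosses 𝒞 A B
  Uncrosses-sym {A} {B} (inj₁ (B∪A , B∩A)) = inj₁ (subst 𝒞 (∪-comm B A) B∪A , subst 𝒞 (∩-comm B A) B∩A)
  Uncrosses-sym         (inj₂ (B─A , A─B)) = inj₂ (A─B , B─A)

  disjoint⇒uncrosses : ∀ {A B} → 𝒞 A → 𝒞 B → Empty (A ∩ B) → Uncrosses 𝒞 A B
  disjoint⇒uncrosses {A} {B} 𝒞A 𝒞B A∩B=∅ = inj₂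
    ( subst 𝒞 (sym (p∩q-Empty⇒p─q≡p A B A∩B=∅)) 𝒞A
    , subst 𝒞 (sym (p∩q-Empty⇒p─q≡p B A (subst Empty (∩-comm A B) A∩B=∅))) 𝒞B )

  covering⇒uncrosses : (∀ {X} → 𝒞 X → 𝒞 (∁ X)) →
    ∀ {A B} → 𝒞 A → 𝒞 B → Empty (∁ (A ∪ B)) → Uncrosses 𝒞 A B
  covering⇒uncrosses 𝒞-∁ {A} {B} 𝒞A 𝒞B ∁[A∪B]=∅ = inj₂
    ( subst 𝒞 (sym (∁[p∪q]-Empty⇒p─q≡∁q A B ∁[A∪B]=∅)) (𝒞-∁ 𝒞B)
    , subst 𝒞 (sym (∁[p∪q]-Empty⇒p─q≡∁q B A (subst (Empty ∘ ∁) (∪-comm A B) ∁[A∪B]=∅))) (𝒞-∁ 𝒞A) )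

  nested⇒uncrosses : ∀ {A B} → 𝒞 A → 𝒞 B → A ⊆ B → Uncrosses 𝒞 A B
  nested⇒uncrosses 𝒞A 𝒞B A⊆B =
    inj₁ (subst 𝒞 (sym (p⊆q⇒p∪q≡q A⊆B)) 𝒞B , subst 𝒞 (sym (p⊆q⇒p∩q≡p A⊆B)) 𝒞A)

module CutFunction {m} (G : MultiGraph n m) (F : Subset m) where

  d : Subset n → ℕ
  d X = ∣ δ G F X ∣

  private
    u v : Fin m → Fin n
    u e = proj₁ (ends G e)
    v e = proj₂ (ends G e)

    -- Whether e ∈ δ_F(X) depends only on e ∈ F and on which endpoints of e lie in X, so every
    -- inequality between cut sizes below is checked edge by edge, on a truth table.
    cross : Bool → Bool → Bool → ℕ
    cross f x x′ = ⟦ f ∧ (x xor x′) ⟧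

    edgewise : {P : Bool → Bool → Bool → Bool → Bool → Set} → (∀ f x y x′ y′ → P f x y x′ y′) →
      ∀ A B e → P (lookup F e) (lookup A (u e)) (lookup B (u e)) (lookup A (v e)) (lookup B (v e))
    edgewise holds A B e = holds _ _ _ _ _

  δ-≗ : ∀ X (φ : Fin n → Bool) → lookup X ≗ φ →
    δ G F X ≡ tabulate λ e → lookup F e ∧ (φ (u e) xor φ (v e))
  δ-≗ X φ X≗φ = tabulate-cong λ e → cong₂ (λ x x′ → lookup F e ∧ (x xor x′)) (X≗φ (u e)) (X≗φ (v e))

  d-∁ : ∀ X → d (∁ X) ≡ d X
  d-∁ X = cong ∣_∣ (trans (δ-≗ (∁ X) (not ∘ lookup X) λ i → lookup-map i not X)
                          (tabulate-cong λ e → cong (lookup F e ∧_) (not-xor-not e)))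
    where
    not-xor-not : ∀ e → not (lookup X (u e)) xor not (lookup X (v e)) ≡ lookup X (u e) xor lookup X (v e)
    not-xor-not e = xor-annihilates-not (lookup X (u e)) (lookup X (v e))

  submodular : ∀ A B → d (A ∩ B) + d (A ∪ B) ≤ d A + d B
  submodular A B
    rewrite δ-≗ (A ∩ B) _ (λ i → lookup-zipWith _∧_ i A B)
          | δ-≗ (A ∪ B) _ (λ i → lookup-zipWith _∨_ i A B)
    = ∣tabulate∣-mono₂ (edgewise at-edge A B)
    where
    at-edge : ∀ f x y x′ y′ →
      cross f (x ∧ y) (x′ ∧ y′) + cross f (x ∨ y) (x′ ∨ y′) ≤ cross f x x′ + cross f y y′
    at-edge = by-truth-table λ _ _ _ _ _ → _ ≤? _

  posimodular : ∀ A B → d (A ─ B) + d (B ─ A) ≤ d A + d B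
  posimodular A B
    rewrite δ-≗ (A ─ B) _ (lookup-─ A B)
          | δ-≗ (B ─ A) _ (lookup-─ B A)
    = ∣tabulate∣-mono₂ (edgewise at-edge A B)
    where
    at-edge : ∀ f x y x′ y′ →
      cross f (x ∧ not y) (x′ ∧ not y′) + cross f (y ∧ not x) (y′ ∧ not x′) ≤ cross f x x′ + cross f y y′
    at-edge = by-truth-table λ _ _ _ _ _ → _ ≤? _

  d[A─B]≤d[A]+d[A∩B] : ∀ A B → d (A ─ B) ≤ d A + d (A ∩ B)
  d[A─B]≤d[A]+d[A∩B] A B
    rewrite δ-≗ (A ─ B) _ (lookup-─ A B)
          | δ-≗ (A ∩ B) _ (λ i → lookup-zipWith _∧_ i A B)
    = ∣tabulate∣-mono₁ (edgewise at-edge A B)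
    where
    at-edge : ∀ f x y x′ y′ →
      cross f (x ∧ not y) (x′ ∧ not y′) ≤ cross f x x′ + cross f (x ∧ y) (x′ ∧ y′)
    at-edge = by-truth-table λ _ _ _ _ _ → _ ≤? _

  d[A─B]≤d[A∪B]+d[B] : ∀ A B → d (A ─ B) ≤ d (A ∪ B) + d B
  d[A─B]≤d[A∪B]+d[B] A B
    rewrite δ-≗ (A ─ B) _ (lookup-─ A B)
          | δ-≗ (A ∪ B) _ (λ i → lookup-zipWith _∨_ i A B)
    = ∣tabulate∣-mono₁ (edgewise at-edge A B)
    where
    at-edge : ∀ f x y x′ y′ →
      cross f (x ∧ not y) (x′ ∧ not y′) ≤ cross f (x ∨ y) (x′ ∨ y′) + cross f y y′
    at-edge = by-truth-table λ _ _ _ _ _ → _ ≤? _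

  d[A─B]<2 : ∀ A B → d A < 2 → d B < 2 → 2 ≤ d (A ∩ B) ⊎ 2 ≤ d (A ∪ B) → d (A ─ B) < 2
  d[A─B]<2 A B dA<2 dB<2 (inj₁ 2≤d[A∩B]) = begin-strict
    d (A ─ B)        ≤⟨ d[A─B]≤d[A∪B]+d[B] A B ⟩
    d (A ∪ B) + d B  ≡⟨ cong (_+ d B) (2≤x⇒y≡0 dA<2 dB<2 (submodular A B) 2≤d[A∩B]) ⟩
    d B              <⟨ dB<2 ⟩
    2                ∎
    where open ≤-Reasoning
  d[A─B]<2 A B dA<2 dB<2 (inj₂ 2≤d[A∪B]) = begin-strict
    d (A ─ B)        ≤⟨ d[A─B]≤d[A]+d[A∩B] A B ⟩
    d A + d (A ∩ B)  ≡⟨ cong (d A +_) (2≤x⇒y≡0 dA<2 dB<2 ∪+∩≤ 2≤d[A∪B]) ⟩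
    d A + 0          ≡⟨ +-identityʳ (d A) ⟩
    d A              <⟨ dA<2 ⟩
    2                ∎
    where
    open ≤-Reasoning
    ∪+∩≤ : d (A ∪ B) + d (A ∩ B) ≤ d A + d B
    ∪+∩≤ = ≤-trans (≤-reflexive (+-comm (d (A ∪ B)) (d (A ∩ B)))) (submodular A B)

module _ {m} (G : MultiGraph n m) (𝒮 : Subset m) (q : ℕ) (F : Subset m) where

  private
    𝒱 = Violated G 𝒮 q F
    module Safe = CutFunction G (F ∩ 𝒮)
    module All  = CutFunction G F

  Violated-∁ : ∀ {X} → 𝒱 X → 𝒱 (∁ X)
  Violated-∁ {X} ((X≠∅ , ∁X≠∅) , safe<2 , size≡) =
    (∁X≠∅ , Nonempty-∁∁ X≠∅) , subst (_< 2) (sym (Safe.d-∁ X)) safe<2 , trans (All.d-∁ X) size≡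

  module _ (feasible : FeasibleFGC G 𝒮 q F) {A B : Subset n} (vA : 𝒱 A) (vB : 𝒱 B) where

    private
      deficient⇒q<d : ∀ {X} → ProperCut X → Safe.d X < 2 → q < All.d X
      deficient⇒q<d pc safe<2 = [ (λ 2≤safe → contradiction 2≤safe (<⇒≱ safe<2)) , id ]′ (feasible _ pc)

      violated-pair : ∀ {X Y} → ProperCut X → ProperCut Y → Safe.d X < 2 → Safe.d Y < 2 →
        All.d X + All.d Y ≤ All.d A + All.d B → 𝒱 X × 𝒱 Y
      violated-pair pcX pcY sX sY bound =
        let dX≡ , dY≡ = squeeze (deficient⇒q<d pcX sX) (deficient⇒q<d pcY sY)
                                (subst₂ (λ a b → _ ≤ a + b) (proj₂ (proj₂ vA)) (proj₂ (proj₂ vB)) bound)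
        in (pcX , sX , dX≡) , (pcY , sY , dY≡)

      differences-violated : Nonempty (A ─ B) → Nonempty (B ─ A) →
        2 ≤ Safe.d (A ∩ B) ⊎ 2 ≤ Safe.d (A ∪ B) → 𝒱 (A ─ B) × 𝒱 (B ─ A)
      differences-violated A─B≠∅ B─A≠∅ big = violated-pair
        (─-proper A─B≠∅ B─A≠∅) (─-proper B─A≠∅ A─B≠∅)
        (Safe.d[A─B]<2 A B sA sB big) (Safe.d[A─B]<2 B A sB sA big′)
        (All.posimodular A B)
        where
        sA = proj₁ (proj₂ vA)
        sB = proj₁ (proj₂ vB)
        big′ = subst₂ (λ I U → 2 ≤ Safe.d I ⊎ 2 ≤ Safe.d U) (∩-comm A B) (∪-comm A B) big

    crossing⇒uncrosses : Nonempty (A ∩ B) → Nonempty (∁ (A ∪ B)) → Nonempty (A ─ B) → Nonempty (B ─ A) →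
      Uncrosses 𝒱 A B
    crossing⇒uncrosses A∩B≠∅ ∁[A∪B]≠∅ A─B≠∅ B─A≠∅
      with ∩-∪-proper A∩B≠∅ ∁[A∪B]≠∅ | Safe.d (A ∩ B) <? 2 | Safe.d (A ∪ B) <? 2
    ... | pc∩ , pc∪ | yes s∩  | yes s∪  = inj₁ (swap (violated-pair pc∩ pc∪ s∩ s∪ (All.submodular A B)))
    ... | _         | no s∩≮2 | _       = inj₂ (differences-violated A─B≠∅ B─A≠∅ (inj₁ (≮⇒≥ s∩≮2)))
    ... | _         | yes _   | no s∪≮2 = inj₂ (differences-violated A─B≠∅ B─A≠∅ (inj₂ (≮⇒≥ s∪≮2)))

lemma3p3 : ∀ {n m : ℕ} (G : MultiGraph n m) (𝒮 : Subset m) (q : ℕ) (F : Subset m) →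
    1 ≤ q → FeasibleFGC G 𝒮 q F → Uncrossable (Violated G 𝒮 q F)
lemma3p3 G 𝒮 q F _ feasible = uncrossable
  where
  𝒱 = Violated G 𝒮 q F
  uncrossable : Uncrossable 𝒱
  uncrossable A B vA vB
    with nonempty? (A ∩ B) | nonempty? (∁ (A ∪ B)) | nonempty? (A ─ B) | nonempty? (B ─ A)
  ... | no A∩B=∅ | _           | _        | _        = disjoint⇒uncrosses 𝒱 vA vB A∩B=∅
  ... | _        | no ∁[A∪B]=∅ | _        | _        = covering⇒uncrosses 𝒱 (Violated-∁ G 𝒮 q F) vA vB ∁[A∪B]=∅
  ... | _        | _           | no A─B=∅ | _        = nested⇒uncrosses 𝒱 vA vB (p─q-Empty⇒p⊆q A B A─B=∅)
  ... | _        | _           | _        | no B─A=∅ =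
    Uncrosses-sym 𝒱 (nested⇒uncrosses 𝒱 vB vA (p─q-Empty⇒p⊆q B A B─A=∅))
  ... | yes A∩B≠∅ | yes ∁[A∪B]≠∅ | yes A─B≠∅ | yes B─A≠∅ =
    crossing⇒uncrosses G 𝒮 q F feasible vA vB A∩B≠∅ ∁[A∪B]≠∅ A─B≠∅ B─A≠∅
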